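{- For every graph $G$ and positive integers $r_1,r_2$, \[ ms_{r_1r_2}(G)\ge r_2\, ms_{r_1}(G)\quad\text{and}\quad cms_{r_1r_2}(G)\ge r_2\, cms_{r_1}(G). \]
   Context: All graphs are simple. For an integer $N$, $[N]=\{0,\dots,N-1\}$. An ordering of $G=(V,E)$ is a bijection $\ell:E\to[|E|]$; edges are consecutive (resp. cyclically consecutive) if their labels are consecutive integers (resp. modulo $|E|$). A graph is $(\le r)$-regular if each vertex has degree at most $r$. $ms_r(\ell)$ (resp. $cms_r(\ell)$) is the largest $s$ such that every $s$ consecutive (resp. cyclically consecutive) edges of $\ell$ form a $(\le r)$-regular subgraph; $ms_r(G)$ and $cms_r(G)$ are the maxima over all orderings of $G$. -}

module Defs where

open import Data.Nat using (ℕ; suc; _+_; _*_; _≤_; _<_)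
open import Data.Fin using (Fin; toℕ)
open import Data.Product using (Σ; ∃; ∃-syntax; _×_; _,_; proj₁; proj₂)
open import Data.Sum using (_⊎_)
open import Data.Empty using (⊥)
open import Relation.Binary.PropositionalEquality using (_≡_; _≢_)
open import Relation.Nullary using (¬_)
open import Function.Bundles using (_⤖_; Bijection)
open import Function.Definitions using (Injective)

record Graph : Set where
  field
    n     : ℕ
    m     : ℕ
    ends  : Fin m → Fin n × Fin n
    loopless : ∀ e → proj₁ (ends e) ≢ proj₂ (ends e)
    simple   : ∀ e e' →
      ((proj₁ (ends e) ≡ proj₁ (ends e') × proj₂ (ends e) ≡ proj₂ (ends e'))
       ⊎ (proj₁ (ends e) ≡ proj₂ (ends e') × proj₂ (ends e) ≡ proj₁ (ends e'))) →
      e ≡ e'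

open Graph public

Vertex : Graph → Set
Vertex G = Fin (n G)

Edge : Graph → Set
Edge G = Fin (m G)

Ordering : Graph → Set
Ordering G = Edge G ⤖ Fin (m G)

label : {G : Graph} → Ordering G → Edge G → Fin (m G)
label ℓ = Bijection.to ℓ

Incident : (G : Graph) → Vertex G → Edge G → Set
Incident G v e = (proj₁ (ends G e) ≡ v) ⊎ (proj₂ (ends G e) ≡ v)

LeRegular : (G : Graph) → ℕ → (Edge G → Set) → Set
LeRegular G r S = ∀ (v : Vertex G) (f : Fin (suc r) → Edge G) →
  Injective _≡_ _≡_ f → ¬ (∀ k → S (f k) × Incident G v (f k))

InWindow : ℕ → ℕ → ℕ → Set
InWindow i s p = i ≤ p × p < i + s

InCycWindow : ℕ → ℕ → ℕ → ℕ → Set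
InCycWindow m i s p = ∃[ j ] ∃[ q ] (j < s × i + j ≡ q * m + p)

GoodOrd : (G : Graph) → ℕ → Ordering G → ℕ → Set
GoodOrd G r ℓ s = ∀ (i : ℕ) → i + s ≤ m G →
  LeRegular G r (λ e → InWindow i s (toℕ (label {G} ℓ e)))

CycGoodOrd : (G : Graph) → ℕ → Ordering G → ℕ → Set
CycGoodOrd G r ℓ s = ∀ (i : Fin (m G)) →
  LeRegular G r (λ e → InCycWindow (m G) (toℕ i) s (toℕ (label {G} ℓ e)))

-- ms_r(G) ≥ s  (ms_r(G) = max over orderings of ms_r(ℓ)).
MsAtLeast : (G : Graph) → ℕ → ℕ → Set
MsAtLeast G r s = ∃[ ℓ ] GoodOrd G r ℓ s

CmsAtLeast : (G : Graph) → ℕ → ℕ → Set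
CmsAtLeast G r s = ∃[ ℓ ] CycGoodOrd G r ℓ s

-- Cut a window of r₂ s consecutive labels into r₂ consecutive blocks of s labels.
-- Each block is (≤ r₁)-regular, and degrees add up under unions, so the whole window
-- is (≤ r₁ r₂)-regular. For cyclic windows the same cutting works once a window
-- starting at any natural number is shown to coincide with one starting at its residue.
module Submission where

open import Defs
open import Data.Nat using (ℕ; zero; suc; _+_; _*_; _≤_; _<_; _∸_; s≤s; NonZero; _<?_)
open import Data.Nat.Properties using (≤-refl; ≤-trans; m≤m+n; +-comm; +-assoc; +-identityʳ; *-suc; ≮⇒≥; <⇒≱; +-cancelˡ-<; m+[n∸m]≡n)
open import Data.Nat.DivMod using (_%_; _/_; m≡m%n+[m/n]*n; m%n<n; m%n%n≡m%n; [m+kn]%n≡m%n; m<n⇒m%n≡m; %-distribˡ-+)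
open import Data.Fin using (Fin; toℕ; fromℕ<; zero; suc)
open import Data.Fin.Properties using (toℕ-fromℕ<; toℕ<n; suc-injective; nonZeroIndex)
open import Data.Product using (Σ; ∃-syntax; _×_; _,_; proj₁; proj₂)
open import Data.Sum using (_⊎_; inj₁; inj₂; [_,_]′; swap) renaming (map to map-⊎)
open import Data.Unit using (⊤; tt)
open import Relation.Nullary using (¬_; yes; no)
open import Relation.Binary.PropositionalEquality
open import Function using (_∘_)
open import Function.Definitions using (Injective)

Picks : ∀ {n} → (Fin n → Set) → ℕ → Set
Picks {n} P k = Σ (Fin k → Fin n) λ h → Injective _≡_ _≡_ h × (∀ i → P (h i))

module _ {n : ℕ} {P : Fin (suc n) → Set} where

  picks-single : P zero → Picks P 1
  picks-single p = (λ _ → zero) , (λ { {zero} {zero} _ → refl }) , λ _ → p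

  picks-shift : ∀ {k} → Picks (P ∘ suc) k → Picks P k
  picks-shift (h , h-inj , h-P) = suc ∘ h , h-inj ∘ suc-injective , h-P

  picks-cons : ∀ {k} → P zero → Picks (P ∘ suc) k → Picks P (suc k)
  picks-cons {k} p (h , h-inj , h-P) = h′ , h′-inj , h′-P
    where
    h′ : Fin (suc k) → Fin (suc n)
    h′ zero    = zero
    h′ (suc i) = suc (h i)
    h′-inj : Injective _≡_ _≡_ h′
    h′-inj {zero}  {zero}  _  = refl
    h′-inj {suc _} {suc _} eq = cong suc (h-inj (suc-injective eq))
    h′-P : ∀ i → P (h′ i)
    h′-P zero    = p
    h′-P (suc i) = h-P i

-- Serves both cases of pigeonhole₂: a first element in Q is handled with P and Q swapped.
pigeonhole-step : ∀ {n} {P Q : Fin (suc n) → Set} a b → P zero →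
  (∀ a′ → suc (a′ + b) ≤ n → Picks (P ∘ suc) (suc a′) ⊎ Picks (Q ∘ suc) (suc b)) →
  suc (a + b) ≤ suc n → Picks P (suc a) ⊎ Picks Q (suc b)
pigeonhole-step {P = P} zero b p _ _ = inj₁ (picks-single {P = P} p)
pigeonhole-step {P = P} {Q} (suc a) b p ind (s≤s a+b<n) =
  map-⊎ (picks-cons {P = P} p) (picks-shift {P = Q}) (ind a a+b<n)

pigeonhole₂ : ∀ {n} {P Q : Fin n → Set} → (∀ x → P x ⊎ Q x) →
  ∀ a b → suc (a + b) ≤ n → Picks P (suc a) ⊎ Picks Q (suc b)
pigeonhole₂ {suc n} {P} {Q} classify a b a+b<n =
  [ (λ p → pigeonhole-step {P = P} {Q} a b p (λ a′ → tail a′ b) a+b<n)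
  , (λ q → swap (pigeonhole-step {P = Q} {P} b a q
                  (λ b′ b′+a<n → swap (tail a b′ (subst (_< n) (+-comm b′ a) b′+a<n)))
                  (subst (_< suc n) (+-comm a b) a+b<n)))
  ]′ (classify zero)
  where
  tail : ∀ a b → suc (a + b) ≤ n → Picks (P ∘ suc) (suc a) ⊎ Picks (Q ∘ suc) (suc b)
  tail = pigeonhole₂ (classify ∘ suc)

module _ (G : Graph) where

  LeRegular-∅ : ∀ r {S : Edge G → Set} → (∀ e → ¬ S e) → LeRegular G r S
  LeRegular-∅ r empty v f f-inj f-in = empty (f zero) (proj₁ (f-in zero))

  LeRegular-mono : ∀ r {S T : Edge G → Set} → (∀ e → S e → T e) → LeRegular G r T → LeRegular G r S
  LeRegular-mono r S⊆T T-reg v f f-inj f-in = T-reg v f f-inj λ k → S⊆T (f k) (proj₁ (f-in k)) , proj₂ (f-in k)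

  LeRegular-∪ : ∀ a b {S A B : Edge G → Set} → (∀ e → S e → A e ⊎ B e) →
    LeRegular G a A → LeRegular G b B → LeRegular G (a + b) S
  LeRegular-∪ a b {A = A} {B} S⊆A∪B A-reg B-reg v f f-inj f-in
    with pigeonhole₂ {P = A ∘ f} {B ∘ f} (λ k → S⊆A∪B (f k) (proj₁ (f-in k))) a b ≤-refl
  ... | inj₁ (h , h-inj , h-A) = A-reg v (f ∘ h) (h-inj ∘ f-inj) λ k → h-A k , proj₂ (f-in (h k))
  ... | inj₂ (h , h-inj , h-B) = B-reg v (f ∘ h) (h-inj ∘ f-inj) λ k → h-B k , proj₂ (f-in (h k))

  -- Win i s p: label p lies in the window of length s starting at i.
  -- Fits i s: the window is one the regularity hypothesis applies to.
  module Concatenation (lab : Edge G → ℕ) (Win : ℕ → ℕ → ℕ → Set) (Fits : ℕ → ℕ → Set)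
    (Win-split : ∀ {i s t p} → Win i (s + t) p → Win i s p ⊎ Win (i + s) t p)
    (Fits-split : ∀ {i s t} → Fits i (s + t) → Fits i s × Fits (i + s) t)
    (Win-empty : ∀ {i p} → ¬ Win i 0 p) where

    LeRegular-concat : ∀ {r s} → (∀ i → Fits i s → LeRegular G r (λ e → Win i s (lab e))) →
      ∀ k i → Fits i (k * s) → LeRegular G (r * k) (λ e → Win i (k * s) (lab e))
    LeRegular-concat {r} _    zero    i _    = LeRegular-∅ (r * 0) (λ e → Win-empty {i} {lab e})
    LeRegular-concat {r} {s} good (suc k) i fits
      with fits-first , fits-rest ← Fits-split {i} {s} {k * s} fits =
      subst (λ d → LeRegular G d (λ e → Win i (suc k * s) (lab e))) (sym (*-suc r k))
        (LeRegular-∪ r (r * k) (λ e → Win-split {i} {s} {k * s} {lab e})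
          (good i fits-first) (LeRegular-concat good k (i + s) fits-rest))

InWindow-split : ∀ {i s t p} → InWindow i (s + t) p → InWindow i s p ⊎ InWindow (i + s) t p
InWindow-split {i} {s} {t} {p} (i≤p , p<i+s+t) with p <? i + s
... | yes p<i+s = inj₁ (i≤p , p<i+s)
... | no  p≮i+s = inj₂ (≮⇒≥ p≮i+s , subst (p <_) (sym (+-assoc i s t)) p<i+s+t)

+-≤-split : ∀ {M i s t} → i + (s + t) ≤ M → i + s ≤ M × i + s + t ≤ M
+-≤-split {M} {i} {s} {t} i+[s+t]≤M = ≤-trans (m≤m+n (i + s) t) i+s+t≤M , i+s+t≤M
  where
  i+s+t≤M : i + s + t ≤ M
  i+s+t≤M = subst (_≤ M) (sym (+-assoc i s t)) i+[s+t]≤M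

InWindow-empty : ∀ {i p} → ¬ InWindow i 0 p
InWindow-empty {i} (i≤p , p<i+0) = <⇒≱ (subst (_ <_) (+-identityʳ i) p<i+0) i≤p

InCycWindow-split : ∀ {M i s t p} → InCycWindow M i (s + t) p → InCycWindow M i s p ⊎ InCycWindow M (i + s) t p
InCycWindow-split {M} {i} {s} {t} {p} (j , q , j<s+t , eq) with j <? s
... | yes j<s = inj₁ (j , q , j<s , eq)
... | no  j≮s = inj₂ (j ∸ s , q , +-cancelˡ-< s (j ∸ s) t (subst (_< s + t) (sym s+[j∸s]≡j) j<s+t) ,
                     trans (+-assoc i s (j ∸ s)) (trans (cong (i +_) s+[j∸s]≡j) eq))
  where
  s+[j∸s]≡j : s + (j ∸ s) ≡ j
  s+[j∸s]≡j = m+[n∸m]≡n (≮⇒≥ j≮s)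

InCycWindow-empty : ∀ {M i p} → ¬ InCycWindow M i 0 p
InCycWindow-empty (_ , _ , () , _)

module _ {M : ℕ} .{{_ : NonZero M}} where

  InCycWindow⇒%≡ : ∀ {i s p} → p < M → InCycWindow M i s p → ∃[ j ] j < s × (i + j) % M ≡ p
  InCycWindow⇒%≡ {i} {p = p} p<M (j , q , j<s , eq) = j , j<s , (begin
    (i + j) % M     ≡⟨ cong (_% M) (trans eq (+-comm (q * M) p)) ⟩
    (p + q * M) % M ≡⟨ [m+kn]%n≡m%n p q M ⟩
    p % M           ≡⟨ m<n⇒m%n≡m p<M ⟩
    p               ∎)
    where open ≡-Reasoning

  %⇒InCycWindow : ∀ {i s j} → j < s → InCycWindow M i s ((i + j) % M)
  %⇒InCycWindow {i} {j = j} j<s =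
    j , (i + j) / M , j<s , trans (m≡m%n+[m/n]*n (i + j) M) (+-comm ((i + j) % M) _)

  [m%n+k]%n≡[m+k]%n : ∀ i j → (i % M + j) % M ≡ (i + j) % M
  [m%n+k]%n≡[m+k]%n i j = begin
    (i % M + j) % M         ≡⟨ %-distribˡ-+ (i % M) j M ⟩
    (i % M % M + j % M) % M ≡⟨ cong (λ x → (x + j % M) % M) (m%n%n≡m%n i M) ⟩
    (i % M + j % M) % M     ≡⟨ %-distribˡ-+ i j M ⟨
    (i + j) % M             ∎
    where open ≡-Reasoning

  InCycWindow-reduce : ∀ {i s p} → p < M → InCycWindow M i s p → InCycWindow M (i % M) s p
  InCycWindow-reduce {i} {s} p<M win with j , j<s , i+j%M≡p ← InCycWindow⇒%≡ p<M win =
    subst (InCycWindow M (i % M) s) (trans ([m%n+k]%n≡[m+k]%n i j) i+j%M≡p) (%⇒InCycWindow j<s)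

module _ (G : Graph) (ℓ : Ordering G) {r s : ℕ} where

  private
    lab : Edge G → ℕ
    lab e = toℕ (label {G} ℓ e)

  GoodOrd-scale : GoodOrd G r ℓ s → ∀ k → GoodOrd G (r * k) ℓ (k * s)
  GoodOrd-scale good k = LeRegular-concat good k
    where
    open Concatenation G lab InWindow (λ i s → i + s ≤ m G) InWindow-split
      (λ {i} {s} {t} → +-≤-split {m G} {i} {s} {t}) InWindow-empty

  CycGoodOrd-anyStart : .{{_ : NonZero (m G)}} → CycGoodOrd G r ℓ s →
    ∀ i → LeRegular G r (λ e → InCycWindow (m G) i s (lab e))
  CycGoodOrd-anyStart good i = LeRegular-mono G r reduce (good (fromℕ< (m%n<n i (m G))))
    where
    reduce : ∀ e → InCycWindow (m G) i s (lab e) → InCycWindow (m G) (toℕ (fromℕ< (m%n<n i (m G)))) s (lab e)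
    reduce e win = subst (λ x → InCycWindow (m G) x s (lab e)) (sym (toℕ-fromℕ< _))
                     (InCycWindow-reduce (toℕ<n (label {G} ℓ e)) win)

  CycGoodOrd-scale : CycGoodOrd G r ℓ s → ∀ k → CycGoodOrd G (r * k) ℓ (k * s)
  CycGoodOrd-scale good k i = LeRegular-concat (λ i _ → CycGoodOrd-anyStart good i) k (toℕ i) tt
    where
    instance _ = nonZeroIndex i
    open Concatenation G lab (InCycWindow (m G)) (λ _ _ → ⊤) InCycWindow-split (λ _ → tt , tt) InCycWindow-empty

proposition33 : (G : Graph) (r₁ r₂ : ℕ) → 1 ≤ r₁ → 1 ≤ r₂ →
    (∀ s → MsAtLeast G r₁ s → MsAtLeast G (r₁ * r₂) (r₂ * s))
    × (∀ s → CmsAtLeast G r₁ s → CmsAtLeast G (r₁ * r₂) (r₂ * s))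
proposition33 G r₁ r₂ _ _ =
  (λ s (ℓ , good) → ℓ , GoodOrd-scale G ℓ good r₂) ,
  (λ s (ℓ , good) → ℓ , CycGoodOrd-scale G ℓ good r₂)
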